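{- For all $i,j\ge0$, the series $$x_{i,j}=\sum_{k=0}^{\infty}(1-\beta_k)\beta_k^j\left[(1-\alpha_k)\alpha_k^i-(1-\alpha_{k+1})\alpha_{k+1}^i\right]$$ and $x_{j,i}$ (defined by the same formula with $i$ and $j$ exchanged) converge in the $z$-adic topology, i.e., they are well-defined formal power series in $z$.
   Context: Work in the ring of formal power series in $z$; for a formal power series $u$ with zero constant term, $\sqrt{1-u}$ denotes the formal square root with constant term $1$. Define $\alpha_0=\frac{1-\sqrt{1-8z^2}}{4z}$, $\beta_0=\frac{\alpha_0^2}{1+\alpha_0^2}$, and for a formal power series $t$ with zero constant term, $f(t)=\frac{1-\sqrt{1-4z^{2}(1+t^2)}}{2z(1+t^2)}\,t$. Define recursively $\alpha_{k+1}=f(\beta_k)$ for $k\ge0$ and $\beta_k=f(\alpha_k)$ for $k\ge1$. Convention: $\alpha^0=\beta^0=1$. -}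

module Defs where

open import Data.Nat as ℕ using (ℕ; zero; suc; _∸_; _≡ᵇ_; _≤_; _<_)
open import Data.Integer using (+_)
open import Data.Rational using (ℚ; 0ℚ; 1ℚ; ½; _+_; _*_; _-_; -_; _/_)
open import Data.Bool using (if_then_else_)
open import Data.Product using (Σ; Σ-syntax; ∃-syntax; _×_; _,_; proj₁; proj₂)
open import Relation.Binary.PropositionalEquality using (_≡_)

-- A formal power series over ℚ in the variable z, given by its coefficients:
-- (a n) is the coefficient of z^n.
FPS : Set
FPS = ℕ → ℚ

sumTo : ℕ → (ℕ → ℚ) → ℚ
sumTo zero    f = 0ℚ
sumTo (suc n) f = sumTo n f + f n

-- course-of-values recursion on coefficients:
-- next n prev computes coefficient n from the previous ones prev 0, …, prev (n-1)
private
  tab : (ℕ → (ℕ → ℚ) → ℚ) → ℕ → (ℕ → ℚ)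
  tab next zero    = λ _ → 0ℚ
  tab next (suc n) = λ k → if k ≡ᵇ n then next n (tab next n) else tab next n k

cov : (ℕ → (ℕ → ℚ) → ℚ) → FPS
cov next n = tab next (suc n) n

zeroS : FPS
zeroS _ = 0ℚ

oneS : FPS
oneS zero    = 1ℚ
oneS (suc _) = 0ℚ

_⊕_ : FPS → FPS → FPS
(a ⊕ b) n = a n + b n

_⊖_ : FPS → FPS → FPS
(a ⊖ b) n = a n - b n

_⊛_ : FPS → FPS → FPS
(a ⊛ b) n = sumTo (suc n) (λ m → a m * b (n ∸ m))

infixl 6 _⊕_ _⊖_
infixl 7 _⊛_

scale : ℚ → FPS → FPS
scale c a n = c * a n

monomial : ℚ → ℕ → FPS
monomial c k n = if n ≡ᵇ k then c else 0ℚ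

_^S_ : FPS → ℕ → FPS
a ^S zero  = oneS
a ^S suc i = (a ^S i) ⊛ a

-- division by z of a series with zero constant term: the unique g with z g = a
divZ : FPS → FPS
divZ a n = a (suc n)

-- the formal square root of 1 - u with constant term 1 (u with zero constant term):
-- s 0 = 1,  s n = ((1-u)_n - Σ_{m=1}^{n-1} s m s (n-m)) / 2  for n ≥ 1
sqrt1m : FPS → FPS
sqrt1m u = cov next
  where
  next : ℕ → (ℕ → ℚ) → ℚ
  next zero    prev = 1ℚ
  next (suc n) prev =
    ½ * (- u (suc n) - sumTo (suc n) (λ m → if m ≡ᵇ 0 then 0ℚ else prev m * prev (suc n ∸ m)))

-- the inverse of 1 + v (v with zero constant term): b 0 = 1, b n = - Σ_{m<n} v (n-m) b m
inv1p : FPS → FPS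
inv1p v = cov next
  where
  next : ℕ → (ℕ → ℚ) → ℚ
  next zero    prev = 1ℚ
  next (suc n) prev = - sumTo (suc n) (λ m → v (suc n ∸ m) * prev m)

zS : FPS
zS = monomial 1ℚ 1

-- α₀ = (1 - √(1 - 8 z²)) / (4 z)
α₀ : FPS
α₀ = scale (+ 1 / 4) (divZ (oneS ⊖ sqrt1m (monomial (+ 8 / 1) 2)))

β₀ : FPS
β₀ = (α₀ ^S 2) ⊛ inv1p (α₀ ^S 2)

-- f(t) = (1 - √(1 - 4 z² (1 + t²))) / (2 z (1 + t²)) · t
f : FPS → FPS
f t = (scale ½ (divZ (oneS ⊖ sqrt1m (monomial (+ 4 / 1) 2 ⊛ (oneS ⊕ (t ^S 2)))))
        ⊛ inv1p (t ^S 2)) ⊛ t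

αβ : ℕ → FPS × FPS
αβ zero    = α₀ , β₀
αβ (suc k) = let a = f (proj₂ (αβ k)) in a , f a

α : ℕ → FPS
α k = proj₁ (αβ k)

β : ℕ → FPS
β k = proj₂ (αβ k)

term : ℕ → ℕ → ℕ → FPS
term i j k = ((oneS ⊖ β k) ⊛ (β k ^S j))
             ⊛ (((oneS ⊖ α k) ⊛ (α k ^S i)) ⊖ ((oneS ⊖ α (suc k)) ⊛ (α (suc k) ^S i)))

partialSum : (ℕ → FPS) → ℕ → FPS
partialSum T zero    = zeroS
partialSum T (suc m) = partialSum T m ⊕ T m

ConvergesZAdic : (ℕ → FPS) → Set
ConvergesZAdic T =
  Σ[ S ∈ FPS ] (∀ N → ∃[ K ] (∀ m → K ≤ m → ∀ n → n < N → partialSum T m n ≡ S n))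

module Submission where

-- Say that a series has order ≥ d when its coefficients of
-- z⁰, …, z^(d-1) vanish, and that two series agree modulo z^d when their
-- difference does.  Agreement modulo z^d is a congruence for the ring
-- operations, and orders add under multiplication.  The prefactor
-- (1 - √(1 - 4z²(1+t²))) / (2z) of f has zero constant term, so f raises the
-- order of its argument by one; by induction α_k and β_k have order ≥ k.
-- Hence α_k ≡ 0 ≡ α_{k+1} modulo z^k, so by congruence
-- (1-α_k)α_k^i ≡ (1-α_{k+1})α_{k+1}^i modulo z^k and the k-th term of
-- x_{i,j} has order ≥ k, for all i and j.  Finally any series Σ T_k whose
-- k-th term has order ≥ k converges z-adically: the coefficient of z^n of
-- the partial sums is constant from the (n+1)-st partial sum on.

open import Defs
open import Data.Nat using (ℕ; zero; suc; _≤_; _<_; _∸_; z≤n; s≤s; _<?_)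
  renaming (_+_ to _+ℕ_)
open import Data.Nat.Properties
  using (≤-trans; ≤-refl; m∸n≤m; m≤n+m; m∸n+n≡m; n≤1+n; ≮⇒≥)
open import Data.Product using (_×_; _,_; proj₁; proj₂)
open import Data.Integer using (+_)
open import Data.Rational using (ℚ; 0ℚ; ½; _+_; _*_; _-_; -_; _/_)
open import Data.Rational.Properties using (*-zeroˡ; *-zeroʳ; +-identityʳ; +-inverseʳ)
open import Relation.Nullary using (yes; no)
open import Relation.Binary.PropositionalEquality using (_≡_; refl; sym; trans; cong; cong₂)

_≈[_]_ : FPS → ℕ → FPS → Set
a ≈[ d ] b = ∀ n → n < d → a n ≡ b n

HasOrder : FPS → ℕ → Set
HasOrder a d = a ≈[ d ] zeroS

≈-weaken : ∀ {a b d e} → e ≤ d → a ≈[ d ] b → a ≈[ e ] b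
≈-weaken e≤d a≈b n n<e = a≈b n (≤-trans n<e e≤d)

sumTo-cong : ∀ K (g h : ℕ → ℚ) → (∀ m → m < K → g m ≡ h m) → sumTo K g ≡ sumTo K h
sumTo-cong zero    g h g≡h = refl
sumTo-cong (suc K) g h g≡h =
  cong₂ _+_ (sumTo-cong K g h (λ m m<K → g≡h m (≤-trans m<K (n≤1+n K)))) (g≡h K ≤-refl)

sumTo-zero : ∀ K (g : ℕ → ℚ) → (∀ m → m < K → g m ≡ 0ℚ) → sumTo K g ≡ 0ℚ
sumTo-zero K g g≡0 = trans (sumTo-cong K g (λ _ → 0ℚ) g≡0) (sumTo-zeros K)
  where
  sumTo-zeros : ∀ K → sumTo K (λ _ → 0ℚ) ≡ 0ℚ
  sumTo-zeros zero    = refl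
  sumTo-zeros (suc K) = trans (+-identityʳ _) (sumTo-zeros K)

-- Agreement modulo z^d is a congruence for subtraction and multiplication:
-- the coefficient of z^n, n < d, of a product only involves coefficients
-- of index ≤ n of the factors.
≈-⊖ : ∀ {a a′ b b′ d} → a ≈[ d ] a′ → b ≈[ d ] b′ → (a ⊖ b) ≈[ d ] (a′ ⊖ b′)
≈-⊖ a≈a′ b≈b′ n n<d = cong₂ _-_ (a≈a′ n n<d) (b≈b′ n n<d)

≈-⊛ : ∀ {a a′ b b′ d} → a ≈[ d ] a′ → b ≈[ d ] b′ → (a ⊛ b) ≈[ d ] (a′ ⊛ b′)
≈-⊛ {a} {a′} {b} {b′} a≈a′ b≈b′ n n<d =
  sumTo-cong (suc n) (λ m → a m * b (n ∸ m)) (λ m → a′ m * b′ (n ∸ m)) factors≈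
  where
  factors≈ : ∀ m → m < suc n → a m * b (n ∸ m) ≡ a′ m * b′ (n ∸ m)
  factors≈ m (s≤s m≤n) =
    cong₂ _*_ (a≈a′ m (≤-trans (s≤s m≤n) n<d))
              (b≈b′ (n ∸ m) (≤-trans (s≤s (m∸n≤m n m)) n<d))

≈-^S : ∀ {a a′ d} i → a ≈[ d ] a′ → (a ^S i) ≈[ d ] (a′ ^S i)
≈-^S zero    a≈a′ n n<d = refl
≈-^S (suc i) a≈a′       = ≈-⊛ (≈-^S i a≈a′) a≈a′

≈⇒⊖-order : ∀ {a b d} → a ≈[ d ] b → HasOrder (a ⊖ b) d
≈⇒⊖-order {b = b} a≈b n n<d = trans (cong (_- b n) (a≈b n n<d)) (+-inverseʳ (b n))

⊛-order : ∀ a b d₁ d₂ → HasOrder a d₁ → HasOrder b d₂ → HasOrder (a ⊛ b) (d₁ +ℕ d₂)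
⊛-order a b d₁ d₂ ord-a ord-b n n<d₁+d₂ =
  sumTo-zero (suc n) (λ m → a m * b (n ∸ m)) summand≡0
  where
  complement< : ∀ d₁ n m → n < d₁ +ℕ d₂ → d₁ ≤ m → m ≤ n → n ∸ m < d₂
  complement< zero      n       m       n<d₂ _         _         = ≤-trans (s≤s (m∸n≤m n m)) n<d₂
  complement< (suc d₁) (suc n) (suc m) (s≤s n<) (s≤s d₁≤m) (s≤s m≤n) = complement< d₁ n m n< d₁≤m m≤n

  summand≡0 : ∀ m → m < suc n → a m * b (n ∸ m) ≡ 0ℚ
  summand≡0 m (s≤s m≤n) with m <? d₁
  ... | yes m<d₁ = trans (cong (_* b (n ∸ m)) (ord-a m m<d₁)) (*-zeroˡ (b (n ∸ m)))
  ... | no  m≮d₁ =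
    trans (cong (a m *_) (ord-b (n ∸ m) (complement< d₁ n m n<d₁+d₂ (≮⇒≥ m≮d₁) m≤n)))
          (*-zeroʳ (a m))

monomial-order : ∀ c k → HasOrder (monomial c k) k
monomial-order c (suc k) zero    _         = refl
monomial-order c (suc k) (suc n) (s≤s n<k) = monomial-order c k n n<k

scale-order : ∀ c {a d} → HasOrder a d → HasOrder (scale c a) d
scale-order c ord-a n n<d = trans (cong (c *_) (ord-a n n<d)) (*-zeroʳ c)

-- If u = O(z²) then (1 - √(1-u))/z has zero constant term: the linear
-- coefficient of √(1-u) is -u₁/2 = 0.
sqrt-quotient-order : ∀ u → HasOrder u 2 → HasOrder (divZ (oneS ⊖ sqrt1m u)) 1
sqrt-quotient-order u ord-u zero _ =
  cong (λ u₁ → 0ℚ - ½ * (- u₁ - (0ℚ + 0ℚ))) (ord-u 1 (s≤s (s≤s z≤n)))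
sqrt-quotient-order u ord-u (suc n) (s≤s ())

-- f raises the order by one, because its prefactor
-- (1 - √(1 - 4z²(1+t²)))/(2z(1+t²)) has zero constant term.
f-order : ∀ t d → HasOrder t d → HasOrder (f t) (suc d)
f-order t d ord-t =
  ⊛-order (prefactor ⊛ inv1p (t ^S 2)) t 1 d
    (⊛-order prefactor (inv1p (t ^S 2)) 1 0 prefactor-order (λ _ ())) ord-t
  where
  radicand : FPS
  radicand = monomial (+ 4 / 1) 2 ⊛ (oneS ⊕ (t ^S 2))

  prefactor : FPS
  prefactor = scale ½ (divZ (oneS ⊖ sqrt1m radicand))

  prefactor-order : HasOrder prefactor 1
  prefactor-order = scale-order ½ (sqrt-quotient-order radicand
    (⊛-order (monomial (+ 4 / 1) 2) (oneS ⊕ (t ^S 2)) 2 0 (monomial-order _ 2) (λ _ ())))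

αβ-order : ∀ k → HasOrder (α k) k × HasOrder (β k) k
αβ-order zero    = (λ _ ()) , (λ _ ())
αβ-order (suc k) = ord-α , ≈-weaken (n≤1+n (suc k)) (f-order (α (suc k)) (suc k) ord-α)
  where
  ord-α : HasOrder (α (suc k)) (suc k)
  ord-α = f-order (β k) k (proj₂ (αβ-order k))

-- The k-th term of x_{i,j} has order ≥ k: α_k ≡ α_{k+1} modulo z^k, so the
-- bracket vanishes modulo z^k.
term-order : ∀ i j k → HasOrder (term i j k) k
term-order i j k =
  ⊛-order ((oneS ⊖ β k) ⊛ (β k ^S j)) (bracket k ⊖ bracket (suc k)) 0 k (λ _ ())
    (≈⇒⊖-order (≈-⊛ (≈-⊖ refl-≈ αₖ≈αₖ₊₁) (≈-^S i αₖ≈αₖ₊₁)))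
  where
  bracket : ℕ → FPS
  bracket l = (oneS ⊖ α l) ⊛ (α l ^S i)

  refl-≈ : oneS ≈[ k ] oneS
  refl-≈ _ _ = refl

  αₖ≈αₖ₊₁ : α k ≈[ k ] α (suc k)
  αₖ≈αₖ₊₁ n n<k = trans (proj₁ (αβ-order k) n n<k)
                        (sym (proj₁ (αβ-order (suc k)) n (≤-trans n<k (n≤1+n k))))

-- A series Σ T_k whose k-th term has order ≥ k converges z-adically; its
-- coefficient of z^n is that of the (n+1)-st partial sum.
order-convergence : ∀ (T : ℕ → FPS) → (∀ k → HasOrder (T k) k) → ConvergesZAdic T
order-convergence T ord-T = limit , λ N → N , stable-beyond
  where
  limit : FPS
  limit n = partialSum T (suc n) n

  stable : ∀ n d → partialSum T (d +ℕ suc n) n ≡ limit n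
  stable n zero    = refl
  stable n (suc d) =
    trans (cong (λ x → partialSum T (d +ℕ suc n) n + x) (ord-T (d +ℕ suc n) n (m≤n+m (suc n) d)))
          (trans (+-identityʳ _) (stable n d))

  stable-beyond : ∀ {N} m → N ≤ m → ∀ n → n < N → partialSum T m n ≡ limit n
  stable-beyond m N≤m n n<N =
    trans (cong (λ m′ → partialSum T m′ n) (sym (m∸n+n≡m (≤-trans n<N N≤m))))
          (stable n (m ∸ suc n))

corollary4 : (i j : ℕ) → ConvergesZAdic (term i j) × ConvergesZAdic (term j i)
corollary4 i j = order-convergence (term i j) (term-order i j)
               , order-convergence (term j i) (term-order j i)
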